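{- Let $S$ be a collection of $0-1$ matrices, $c$ a constant, and $g$ a function such that $exs(m,n,S) \le g(m) + cn$ for all positive integers $m,n$. Then for every integer $k > c$ and every $m$, $exs_k(m,S) \le \frac{g(m)}{k-c}$.
   Context: A $0-1$ matrix $A$ contains a $0-1$ matrix $M$ if some submatrix of $A$ can be transformed into $M$ by changing some ones to zeroes; otherwise $A$ avoids $M$. For a collection $S$ of $0-1$ matrices, $exs(m,n,S)$ is the maximum number of ones in an $m\times n$ $0-1$ matrix avoiding every matrix in $S$, and $exs_k(m,S)$ is the maximum number of columns in a $0-1$ matrix with $m$ rows which avoids every matrix in $S$ and has at least $k$ ones in every column.
   Formalization: The constant c and the function g take rational values. -}

module Defs where

open import Data.Nat as ℕ using (ℕ; zero; suc)
open import Data.Bool using (Bool; true; false)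
open import Data.Fin using (Fin; zero; suc)
import Data.Fin as Fin
open import Data.Integer as ℤ using (ℤ; +_)
open import Data.Rational as ℚ using (ℚ; 0ℚ; _/_)
open import Data.Product using (Σ; _×_)
open import Relation.Binary.PropositionalEquality using (_≡_)
open import Relation.Nullary using (¬_)

Matrix : ℕ → ℕ → Set
Matrix m n = Fin m → Fin n → Bool

countOnes : ∀ {n} → (Fin n → Bool) → ℕ
countOnes {zero}  v = 0
countOnes {suc n} v = if' (v zero) ℕ.+ countOnes (λ i → v (suc i))
  where
  if' : Bool → ℕ
  if' true  = 1
  if' false = 0

ones : ∀ {m n} → Matrix m n → ℕ
ones {zero}  A = 0
ones {suc m} A = countOnes (A zero) ℕ.+ ones (λ i → A (suc i))

columnOnes : ∀ {m n} → Matrix m n → Fin n → ℕ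
columnOnes A j = countOnes (λ i → A i j)

StrictlyIncreasing : ∀ {r m} → (Fin r → Fin m) → Set
StrictlyIncreasing f = ∀ i j → i Fin.< j → f i Fin.< f j

-- A contains M: some submatrix of A (rows f(0)<...<f(r-1), columns
-- h(0)<...<h(s-1)) becomes M after changing some ones to zeroes,
-- i.e. every one of M sits on a one of that submatrix.
Contains : ∀ {m n r s} → Matrix m n → Matrix r s → Set
Contains {m} {n} {r} {s} A M =
  Σ (Fin r → Fin m) λ f → Σ (Fin s → Fin n) λ h →
    StrictlyIncreasing f × StrictlyIncreasing h ×
    (∀ i j → M i j ≡ true → A (f i) (h j) ≡ true)

-- A collection S of 0-1 matrices (of arbitrary dimensions, possibly infinite).
Collection : Set₁
Collection = (r s : ℕ) → Matrix r s → Set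

AvoidsAll : ∀ {m n} → Collection → Matrix m n → Set
AvoidsAll S A = ∀ r s (M : Matrix r s) → S r s M → ¬ Contains A M

ℕ→ℚ : ℕ → ℚ
ℕ→ℚ n = (+ n) / 1

ℤ→ℚ : ℤ → ℚ
ℤ→ℚ k = k / 1

-- "exs(m,n,S) ≤ b": every m × n matrix avoiding S has at most b ones.
-- (exs is a maximum over a finite nonempty set, so this is exactly max ≤ b.)
ExsLe : Collection → ℕ → ℕ → ℚ → Set
ExsLe S m n b = (A : Matrix m n) → AvoidsAll S A → ℕ→ℚ (ones A) ℚ.≤ b

-- "exs_k(m,S) ≤ b": every matrix with m rows (and n ≥ 1 columns) avoiding S
-- with at least k ones in every column has at most b columns.
ExsKLe : Collection → ℤ → ℕ → ℚ → Set
ExsKLe S k m b = (n : ℕ) → 1 ℕ.≤ n → (A : Matrix m n) → AvoidsAll S A →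
  (∀ j → ℤ→ℚ k ℚ.≤ ℕ→ℚ (columnOnes A j)) → ℕ→ℚ n ℚ.≤ b

divPos : ℚ → (d : ℚ) → 0ℚ ℚ.< d → ℚ
divPos x d p = ℚ._÷_ x d {{ℚ.>-nonZero p}}

posDiff : ∀ c k → c ℚ.< k → 0ℚ ℚ.< k ℚ.- c
posDiff c k c<k = <-respˡ-≡ (+-inverseʳ c) (+-monoˡ-< (ℚ.- c) c<k)
  where open import Data.Rational.Properties using (<-respˡ-≡; +-inverseʳ; +-monoˡ-<)

module Submission where

-- Let A be an m × n matrix avoiding S whose columns each
-- contain at least k ones.  Counting the ones of A column by column gives
--     n · k  ≤  ones A  ≤  exs(m, n, S)  ≤  g(m) + c · n,
-- hence n · (k − c) ≤ g(m), and since k − c > 0 we may divide: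
-- n ≤ g(m) / (k − c).

open import Defs
open import Data.Nat using (ℕ)
open import Data.Integer using (ℤ)
open import Data.Rational using (ℚ; _+_; _*_; _-_; _<_; _≤_)

import Data.Nat as ℕ
import Data.Nat.Properties as ℕ
open import Data.Nat.Coprimality using (1-coprimeTo) renaming (sym to coprime-sym)
import Data.Integer as ℤ
import Data.Integer.Properties as ℤ
open import Data.Rational using (mkℚ; _/_; 0ℚ; 1ℚ; -_; 1/_; _÷_; Positive; NonZero; positive; >-nonZero)
open import Data.Rational.Properties
open import Data.Rational.Solver using (module +-*-Solver)
open import Data.Bool using (Bool; true; false)
open import Data.Fin using (Fin; zero; suc)
open import Algebra.Properties.CommutativeMonoid.Sum ℕ.+-0-commutativeMonoid
  using (sum; sum-cong-≗; ∑-comm)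
open import Relation.Binary.PropositionalEquality
  using (_≡_; refl; sym; trans; cong; cong₂; module ≡-Reasoning)

bit : Bool → ℕ
bit true  = 1
bit false = 0

countOnes-as-sum : ∀ {n} (v : Fin n → Bool) → countOnes v ≡ sum (λ i → bit (v i))
countOnes-as-sum {ℕ.zero}  v = refl
countOnes-as-sum {ℕ.suc n} v with v zero
... | true  = cong (1 ℕ.+_) (countOnes-as-sum (λ i → v (suc i)))
... | false = countOnes-as-sum (λ i → v (suc i))

ones-as-row-sum : ∀ {m n} (A : Matrix m n) → ones A ≡ sum (λ i → countOnes (A i))
ones-as-row-sum {ℕ.zero}  A = refl
ones-as-row-sum {ℕ.suc m} A = cong (countOnes (A zero) ℕ.+_) (ones-as-row-sum (λ i → A (suc i)))

ones-as-column-sum : ∀ {m n} (A : Matrix m n) → ones A ≡ sum (columnOnes A)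
ones-as-column-sum A = begin
  ones A                                      ≡⟨ ones-as-row-sum A ⟩
  sum (λ i → countOnes (A i))                 ≡⟨ sum-cong-≗ (λ i → countOnes-as-sum (A i)) ⟩
  sum (λ i → sum (λ j → bit (A i j)))         ≡⟨ ∑-comm (λ i j → bit (A i j)) ⟩
  sum (λ j → sum (λ i → bit (A i j)))         ≡⟨ sum-cong-≗ (λ j → sym (countOnes-as-sum (λ i → A i j))) ⟩
  sum (columnOnes A)                          ∎
  where open ≡-Reasoning

ℤ→ℚ-normal : ∀ i → ℤ→ℚ i ≡ mkℚ i 0 (coprime-sym (1-coprimeTo _))
ℤ→ℚ-normal i = ↥p/↧p≡p (mkℚ i 0 (coprime-sym (1-coprimeTo _)))

ℕ→ℚ-+ : ∀ a b → ℕ→ℚ (a ℕ.+ b) ≡ ℕ→ℚ a + ℕ→ℚ b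
ℕ→ℚ-+ a b = begin
  (ℤ.+ (a ℕ.+ b)) / 1                           ≡⟨ /-cong numerators refl ⟩
  (ℤ.+ a ℤ.* ℤ.+ 1 ℤ.+ ℤ.+ b ℤ.* ℤ.+ 1) / 1     ≡⟨⟩
  normal (ℤ.+ a) + normal (ℤ.+ b)               ≡⟨ sym (cong₂ _+_ (ℤ→ℚ-normal (ℤ.+ a)) (ℤ→ℚ-normal (ℤ.+ b))) ⟩
  ℕ→ℚ a + ℕ→ℚ b                                 ∎
  where
  open ≡-Reasoning
  normal : ℤ → ℚ
  normal i = mkℚ i 0 (coprime-sym (1-coprimeTo _))
  -- the numerator of a/1 + b/1 before normalisation
  numerators : ℤ.+ (a ℕ.+ b) ≡ ℤ.+ a ℤ.* ℤ.+ 1 ℤ.+ ℤ.+ b ℤ.* ℤ.+ 1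
  numerators = trans (ℤ.pos-+ a b)
    (sym (cong₂ ℤ._+_ (ℤ.*-identityʳ (ℤ.+ a)) (ℤ.*-identityʳ (ℤ.+ b))))

sum-lower-bound : ∀ {n} (q : ℚ) (f : Fin n → ℕ) →
  (∀ j → q ≤ ℕ→ℚ (f j)) → ℕ→ℚ n * q ≤ ℕ→ℚ (sum f)
sum-lower-bound {ℕ.zero}  q f q≤f = ≤-reflexive (*-zeroˡ q)
sum-lower-bound {ℕ.suc n} q f q≤f = begin
  ℕ→ℚ (ℕ.suc n) * q                    ≡⟨ cong (_* q) (ℕ→ℚ-+ 1 n) ⟩
  (1ℚ + ℕ→ℚ n) * q                     ≡⟨ *-distribʳ-+ q 1ℚ (ℕ→ℚ n) ⟩
  1ℚ * q + ℕ→ℚ n * q                   ≡⟨ cong (_+ ℕ→ℚ n * q) (*-identityˡ q) ⟩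
  q + ℕ→ℚ n * q                        ≤⟨ +-mono-≤ (q≤f zero) (sum-lower-bound q (λ j → f (suc j)) (λ j → q≤f (suc j))) ⟩
  ℕ→ℚ (f zero) + ℕ→ℚ (sum (λ j → f (suc j))) ≡⟨ sym (ℕ→ℚ-+ (f zero) _) ⟩
  ℕ→ℚ (sum f)                          ∎
  where open ≤-Reasoning

≤-divPos : ∀ x y d (d>0 : 0ℚ < d) → x * d ≤ y → x ≤ divPos y d d>0
≤-divPos x y d d>0 xd≤y = *-cancelʳ-≤-pos d {{d-pos}} (begin
  x * d                         ≤⟨ xd≤y ⟩
  y                             ≡⟨ sym (*-identityʳ y) ⟩
  y * 1ℚ                        ≡⟨ cong (y *_) (sym (*-inverseˡ d)) ⟩
  y * (1/ d * d)                ≡⟨ sym (*-assoc y (1/ d) d) ⟩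
  (y ÷ d) * d                   ∎)
  where
  open ≤-Reasoning
  instance
    d≢0 : NonZero d
    d≢0 = >-nonZero d>0
  d-pos : Positive d
  d-pos = positive d>0

solve-for-N : ∀ N K c g (K-c>0 : 0ℚ < K - c) →
  N * K ≤ g + c * N → N ≤ divPos g (K - c) K-c>0
solve-for-N N K c g K-c>0 NK≤g+cN = ≤-divPos N g (K - c) K-c>0 (begin
  N * (K - c)                   ≡⟨ expand ⟩
  N * K - c * N                 ≤⟨ +-monoˡ-≤ (- (c * N)) NK≤g+cN ⟩
  g + c * N - c * N             ≡⟨ cancel ⟩
  g                             ∎)
  where
  open ≤-Reasoning
  open +-*-Solver
  expand : N * (K - c) ≡ N * K - c * N
  expand = solve 3 (λ N K c → N :* (K :- c) := N :* K :- c :* N) refl N K c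
  cancel : g + c * N - c * N ≡ g
  cancel = solve 3 (λ g c N → g :+ c :* N :- c :* N := g) refl g c N

mainTheorem2 : (S : Collection) (c : ℚ) (g : ℕ → ℚ) →
    (∀ m n → 1 Data.Nat.≤ m → 1 Data.Nat.≤ n → ExsLe S m n (g m + c * ℕ→ℚ n)) →
    (k : ℤ) (k>c : c < ℤ→ℚ k) (m : ℕ) → 1 Data.Nat.≤ m →
    ExsKLe S k m (divPos (g m) (ℤ→ℚ k - c) (posDiff c (ℤ→ℚ k) k>c))
mainTheorem2 S c g exs≤ k k>c m m≥1 n n≥1 A A-avoids k≤columns =
  solve-for-N (ℕ→ℚ n) (ℤ→ℚ k) c (g m) (posDiff c (ℤ→ℚ k) k>c) (begin
    ℕ→ℚ n * ℤ→ℚ k               ≤⟨ sum-lower-bound (ℤ→ℚ k) (columnOnes A) k≤columns ⟩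
    ℕ→ℚ (sum (columnOnes A))    ≡⟨ cong ℕ→ℚ (sym (ones-as-column-sum A)) ⟩
    ℕ→ℚ (ones A)                ≤⟨ exs≤ m n m≥1 n≥1 A A-avoids ⟩
    g m + c * ℕ→ℚ n             ∎)
  where open ≤-Reasoning
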